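{- Let $X,Y$ be join-semilattices, let $(X\times Y,\vee)$ be any quasi-product of $X$ and $Y$, and let $x\in X$. Then the map $F_x:Y\to X\times Y$, $y\mapsto(x,y)$, is a join-embedding.
   Context: A quasi-product of join-semilattices $X$ and $Y$ is a join-semilattice structure $(X\times Y,\vee)$ on the set $X\times Y$ such that (q1) for every $x\in X$, the map $F_x:Y\to X\times Y$, $y\mapsto(x,y)$, is an order-embedding (injective, isotone, with isotone inverse); and (q2) the projection $\pi_X:X\times Y\to X$ is a join-homomorphism. A join-embedding is an injective join-homomorphism. -}

module Defs where

open import Level using (Level; _⊔_; suc)
open import Data.Product using (_×_; _,_; proj₁; proj₂)
open import Data.Product.Relation.Binary.Pointwise.NonDependent using (Pointwise)
open import Relation.Binary.Core using (Rel)
open import Relation.Binary.Lattice.Bundles using (JoinSemilattice)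
open import Relation.Binary.Lattice.Structures using (IsJoinSemilattice)
open import Algebra.Core using (Op₂)

module _ {c ℓ₁ ℓ₂ c′ ℓ₁′ ℓ₂′ : Level}
         (X : JoinSemilattice c ℓ₁ ℓ₂) (Y : JoinSemilattice c′ ℓ₁′ ℓ₂′) where

  private
    module X = JoinSemilattice X
    module Y = JoinSemilattice Y

  _≈P_ : Rel (X.Carrier × Y.Carrier) (ℓ₁ ⊔ ℓ₁′)
  _≈P_ = Pointwise X._≈_ Y._≈_

  -- A quasi-product of X and Y: a join-semilattice structure (X × Y, ≤, ∨)
  -- on the set X × Y (order arbitrary, not necessarily the product order) s.t.
  --  (q1) for every x, F_x : y ↦ (x , y) is an order-embedding
  --       (injective, isotone, with isotone inverse);
  --  (q2) the projection π_X is a join-homomorphism.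
  record QuasiProduct (ℓ : Level) : Set (c ⊔ ℓ₁ ⊔ ℓ₂ ⊔ c′ ⊔ ℓ₁′ ⊔ ℓ₂′ ⊔ suc ℓ) where
    field
      _≤_ : Rel (X.Carrier × Y.Carrier) ℓ
      _∨_ : Op₂ (X.Carrier × Y.Carrier)
      isJoinSemilattice : IsJoinSemilattice _≈P_ _≤_ _∨_
      F-injective : ∀ x {y y′} → (x , y) ≈P (x , y′) → y Y.≈ y′
      F-isotone : ∀ x {y y′} → y Y.≤ y′ → (x , y) ≤ (x , y′)
      F-isotone⁻¹ : ∀ x {y y′} → (x , y) ≤ (x , y′) → y Y.≤ y′
      π-join : ∀ p q → proj₁ (p ∨ q) X.≈ (proj₁ p X.∨ proj₁ q)

  IsJoinEmbedding-F : ∀ {ℓ} → QuasiProduct ℓ → X.Carrier → Set (c′ ⊔ ℓ₁ ⊔ ℓ₁′)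
  IsJoinEmbedding-F Q x =
    (∀ {y y′} → (x , y) ≈P (x , y′) → y Y.≈ y′) ×
    (∀ y y′ → (x , (y Y.∨ y′)) ≈P ((x , y) ∨ (x , y′)))
    where open QuasiProduct Q

{-# OPTIONS --safe #-}
module Submission where

-- By (q2) and idempotence of the join in X, the join of (x , y) and (x , y′)
-- lies again in the fibre over x. By (q1) the order of the quasi-product
-- restricted to that fibre is the order of Y, so the join there must be the
-- least upper bound y ∨ y′ of Y.

open import Defs
open import Level using (Level)
open import Data.Product using (_,_; proj₁; proj₂)
open import Relation.Binary.Lattice.Bundles using (JoinSemilattice)
open import Relation.Binary.Lattice.Structures using (IsJoinSemilattice)
import Relation.Binary.Lattice.Properties.JoinSemilattice as JoinSemilatticeProperties

module Fibre {c ℓ₁ ℓ₂ c′ ℓ₁′ ℓ₂′ ℓ : Level}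
  (X : JoinSemilattice c ℓ₁ ℓ₂) (Y : JoinSemilattice c′ ℓ₁′ ℓ₂′)
  (Q : QuasiProduct X Y ℓ) (x : JoinSemilattice.Carrier X) where

  private
    module X = JoinSemilattice X
    module Y = JoinSemilattice Y
    open QuasiProduct Q
    module Q = IsJoinSemilattice isJoinSemilattice

  fibreJoin : Y.Carrier → Y.Carrier → Y.Carrier
  fibreJoin y y′ = proj₂ ((x , y) ∨ (x , y′))

  F-join-in-fibre : ∀ y y′ → _≈P_ X Y ((x , y) ∨ (x , y′)) (x , fibreJoin y y′)
  F-join-in-fibre y y′ =
    X.Eq.trans (π-join (x , y) (x , y′)) (JoinSemilatticeProperties.∨-idempotent X x) ,
    Y.Eq.refl

  y≤fibreJoin : ∀ {y y′} → y Y.≤ fibreJoin y y′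
  y≤fibreJoin {y} {y′} =
    F-isotone⁻¹ x (proj₁ Q.≤-resp-≈ (F-join-in-fibre y y′) (Q.x≤x∨y _ _))

  y′≤fibreJoin : ∀ {y y′} → y′ Y.≤ fibreJoin y y′
  y′≤fibreJoin {y} {y′} =
    F-isotone⁻¹ x (proj₁ Q.≤-resp-≈ (F-join-in-fibre y y′) (Q.y≤x∨y _ _))

  fibreJoin-least : ∀ {y y′ z} → y Y.≤ z → y′ Y.≤ z → fibreJoin y y′ Y.≤ z
  fibreJoin-least {y} {y′} y≤z y′≤z =
    F-isotone⁻¹ x (proj₂ Q.≤-resp-≈ (F-join-in-fibre y y′)
                                    (Q.∨-least (F-isotone x y≤z) (F-isotone x y′≤z)))

  fibreJoin≈∨ : ∀ y y′ → fibreJoin y y′ Y.≈ (y Y.∨ y′)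
  fibreJoin≈∨ y y′ =
    Y.antisym (fibreJoin-least (Y.x≤x∨y y y′) (Y.y≤x∨y y y′))
              (Y.∨-least y≤fibreJoin y′≤fibreJoin)

  F-∨-homomorphic : ∀ y y′ → _≈P_ X Y (x , (y Y.∨ y′)) ((x , y) ∨ (x , y′))
  F-∨-homomorphic y y′ =
    Q.Eq.sym (Q.Eq.trans (F-join-in-fibre y y′) (X.Eq.refl , fibreJoin≈∨ y y′))

lemma3p7 : ∀ {c ℓ₁ ℓ₂ c′ ℓ₁′ ℓ₂′ ℓ : Level}
             (X : JoinSemilattice c ℓ₁ ℓ₂) (Y : JoinSemilattice c′ ℓ₁′ ℓ₂′)
             (Q : QuasiProduct X Y ℓ) (x : JoinSemilattice.Carrier X) →
             IsJoinEmbedding-F X Y Q x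
lemma3p7 X Y Q x = QuasiProduct.F-injective Q x , Fibre.F-∨-homomorphic X Y Q x
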